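{- Let $\mathcal{P}$ be a poset on $[n]$, let $\chi$ be a nontrivial additive character of $\mathbb{F}_q$, and let $I,J\in\mathcal{I}(\mathcal{P})$. Then for every $u\in S_I$, $$\sum_{v\in S_{J^c}}\chi(u\cdot v)=\begin{cases}(-1)^{|I\cap J^c|}(q-1)^{|M(J^c)|-|I\cap J^c|}q^{|(J^c)_M|}&\text{if } I_M\cap J^c=\emptyset,\\ 0&\text{if } I_M\cap J^c\neq\emptyset.\end{cases}$$
   Context: Poset conventions: - $\mathcal{P}$ is a partial order on $[n]$, $\mathcal{I}(\mathcal{P})$ is its set of order ideals, and $\mathcal{P}^*$ is the dual poset. - $M(I)$ is the set of maximal elements of $I$ in $\mathcal{P}$, and $I_M=I\setminus M(I)$. - $J^c=[n]\setminus J\in\mathcal{I}(\mathcal{P}^*)$. $M(J^c)$ is its set of maximal elements with respect to $\mathcal{P}^*$, and $(J^c)_M=J^c\setminus M(J^c)$. Spheres: - $S_I=\{v\in\mathbb{F}_q^n:\langle\mathrm{supp}(v)\rangle_{\mathcal{P}}=I\}$ and $S_{J^c}=\{v\in\mathbb{F}_q^n:\langle\mathrm{supp}(v)\rangle_{\mathcal{P}^*}=J^c\}$. - Here $\mathrm{supp}(v)=\{i:v_i\ne0\}$, and $\langle X\rangle$ is the smallest order ideal containing $X$ in the indicated poset. $u\cdot v$ is the standard dot product. -}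

module Defs where

open import Level using (Level; _⊔_) renaming (suc to lsuc)
open import Data.Nat using (ℕ; zero; suc; _∸_)
open import Data.Bool using (Bool; true; false; _∧_; not; if_then_else_)
import Data.Bool as Bool
open import Data.Fin using (Fin; zero; suc; _≟_)
open import Data.Fin.Subset using (Subset; _∈_; _∩_; ∁; _─_; ∣_∣; ⊥)
open import Data.Fin.Subset.Properties using (_∈?_)
open import Data.Fin.Properties using (any?)
open import Data.Vec using (tabulate)
open import Data.Vec.Properties using (≡-dec)
open import Data.Vec.Functional using (_∷_)
open import Data.List using (List; length; foldr; map)
open import Data.List.Membership.Propositional using () renaming (_∈_ to _∈ₗ_)
open import Data.List.Relation.Unary.Unique.Propositional using (Unique)
open import Data.Product using (∃; _×_; _,_)
open import Data.Sum using (_⊎_)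
open import Function using (flip; _∘_)
open import Relation.Nullary using (¬_; does; ¬?)
open import Relation.Nullary.Decidable using (_×-dec_)
open import Relation.Binary.Core using (Rel)
open import Relation.Binary.Definitions using (Decidable; DecidableEquality)
open import Relation.Binary.Structures using (IsPartialOrder)
open import Relation.Binary.PropositionalEquality using (_≡_; _≢_)
open import Algebra.Core using (Op₁; Op₂)
open import Algebra.Structures using (IsCommutativeRing)
open import Algebra.Bundles using (CommutativeRing; Semiring)
import Algebra.Definitions.RawSemiring as RS

record FiniteField : Set₁ where
  infixl 6 _+_
  infixl 7 _*_
  field
    Carrier : Set
    _+_ _*_ : Op₂ Carrier
    -_ : Op₁ Carrier
    0# 1# : Carrier
    isCommutativeRing : IsCommutativeRing _≡_ _+_ _*_ -_ 0# 1#
    0≢1 : 0# ≢ 1#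
    inverse : ∀ x → x ≢ 0# → ∃ λ y → x * y ≡ 1#
    _≟F_ : DecidableEquality Carrier
    elements : List Carrier
    elements-unique : Unique elements
    elements-complete : ∀ x → x ∈ₗ elements

  q : ℕ
  q = length elements

record IsIntegralDomain {c ℓ} (R : CommutativeRing c ℓ) : Set (c ⊔ ℓ) where
  open CommutativeRing R
  field
    1≉0 : ¬ (1# ≈ 0#)
    noZeroDivisors : ∀ x y → x * y ≈ 0# → x ≈ 0# ⊎ y ≈ 0#

record AdditiveCharacter {c ℓ} (F : FiniteField) (R : CommutativeRing c ℓ)
       : Set (c ⊔ ℓ) where
  private module F = FiniteField F
  open CommutativeRing R
  field
    χ : F.Carrier → Carrier
    χ-+ : ∀ a b → χ (a F.+ b) ≈ χ a * χ b
    χ-0 : χ F.0# ≈ 1#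

Nontrivial : ∀ {c ℓ} {F : FiniteField} {R : CommutativeRing c ℓ} →
             AdditiveCharacter F R → Set ℓ
Nontrivial {R = R} ψ =
  ∃ λ a → ¬ (AdditiveCharacter.χ ψ a ≈ 1#)
  where open CommutativeRing R

record FinPoset (n : ℕ) : Set₁ where
  field
    _≼_ : Rel (Fin n) Level.zero
    isPartialOrder : IsPartialOrder _≡_ _≼_
    _≼?_ : Decidable _≼_

module _ {n : ℕ} (P : FinPoset n) where
  open FinPoset P

  IsIdeal : Subset n → Set
  IsIdeal I = ∀ {i j} → j ∈ I → i ≼ j → i ∈ I

  _≽?_ : Decidable (flip _≼_)
  i ≽? j = j ≼? i

  ideal⟨_⟩ : Subset n → Subset n
  ideal⟨ X ⟩ = tabulate λ i → does (any? λ j → (j ∈? X) ×-dec (i ≼? j))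

  ideal*⟨_⟩ : Subset n → Subset n
  ideal*⟨ X ⟩ = tabulate λ i → does (any? λ j → (j ∈? X) ×-dec (i ≽? j))

  maxP : Subset n → Subset n
  maxP X = tabulate λ i → does (i ∈? X) ∧
    not (does (any? λ j → (j ∈? X) ×-dec ((i ≼? j) ×-dec ¬? (i ≟ j))))

  maxP* : Subset n → Subset n
  maxP* X = tabulate λ i → does (i ∈? X) ∧
    not (does (any? λ j → (j ∈? X) ×-dec ((i ≽? j) ×-dec ¬? (i ≟ j))))

module _ (F : FiniteField) where
  open FiniteField F

  supp : ∀ {n} → (Fin n → Carrier) → Subset n
  supp v = tabulate λ i → not (does (v i ≟F 0#))

  dotF : ∀ {n} → (Fin n → Carrier) → (Fin n → Carrier) → Carrier
  dotF {zero} u v = 0#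
  dotF {suc n} u v = u zero * v zero + dotF (u ∘ suc) (v ∘ suc)

module _ {c ℓ} (F : FiniteField) (R : CommutativeRing c ℓ) where
  private module F = FiniteField F
  open CommutativeRing R

  sumList : List Carrier → Carrier
  sumList = foldr _+_ 0#

  sumAll : (n : ℕ) → ((Fin n → F.Carrier) → Carrier) → Carrier
  sumAll zero f = f (λ ())
  sumAll (suc n) f =
    sumList (map (λ a → sumAll n (λ v → f (a ∷ v))) F.elements)

  -- Σ_{v ∈ S_{J^c}} χ(u · v), where S_{J^c} = {v : ⟨supp v⟩_{P*} = [n] ∖ J}
  charSum : ∀ {n} → FinPoset n → AdditiveCharacter F R →
            (Fin n → F.Carrier) → Subset n → Carrier
  charSum {n} P ψ u J = sumAll n λ v →
    if does (≡-dec Bool._≟_ (ideal*⟨_⟩ P (supp F v)) (∁ J))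
    then AdditiveCharacter.χ ψ (dotF F u v)
    else 0#

  rhsValue : ∀ {n} → FinPoset n → Subset n → Subset n → Carrier
  rhsValue P I J =
    ((- 1#) ^ k) * (((F.q ∸ 1) ·ₙ 1#) ^ (m ∸ k)) * ((F.q ·ₙ 1#) ^ r)
    where
      open RS (Semiring.rawSemiring semiring) using (_^_) renaming (_×_ to _·ₙ_)
      Jc = ∁ J
      k = ∣ I ∩ Jc ∣
      m = ∣ maxP* P Jc ∣
      r = ∣ Jc ─ maxP* P Jc ∣

module Submission where

open import Defs
open import Data.Nat using (ℕ)
open import Data.Fin using (Fin)
open import Data.Fin.Subset using (Subset; _∩_; _─_; ∁; ⊥)
open import Data.Product using (_×_)
open import Relation.Nullary using (¬_)
open import Relation.Binary.PropositionalEquality using (_≡_)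
open import Algebra.Bundles using (CommutativeRing)

-- An ideal K of a finite poset is generated by a set S exactly when S ⊆ K
-- and S contains every maximal element of K.  Applied in the dual poset to
-- K = J^c, this makes S_{J^c} a product set: v ∈ S_{J^c} iff v_i = 0 on J,
-- v_i ≠ 0 on M(J^c), and v_i is arbitrary on (J^c)_M.  As χ(u · v) is the
-- product of the χ(u_i v_i), the sum factorises into one-dimensional sums,
-- which for a nontrivial character with values in an integral domain are
-- 1 on J, −1 or q − 1 on M(J^c) (u_i ≠ 0 or u_i = 0) and 0 or q on (J^c)_M.
-- The same criterion applied to I gives M(I) ⊆ supp u ⊆ I.  If I_M ∩ J^c is
-- empty, then u is nonzero exactly on the part I ∩ J^c of M(J^c) and
-- vanishes on (J^c)_M, which yields the stated product; otherwise a maximal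
-- element of I above a point of I_M ∩ J^c lies in (J^c)_M with u_m ≠ 0, so
-- one factor is 0.

open import Function using (_∘_; flip)
open import Function.Bundles using (_⇔_; Equivalence; mk⇔)
import Function.Properties.Equivalence as ⇔
open import Data.Empty using (⊥-elim)
open import Data.Nat using (zero; suc; _∸_)
open import Data.Nat.Properties using (+-∸-assoc)
open import Data.Bool using (true; false; if_then_else_)
import Data.Bool as Bool
open import Data.Product using (∃; _,_; proj₁; proj₂)
open import Data.Sum using ([_,_]′)
open import Data.List using (List; []; _∷_; length; map; foldr)
open import Data.List.Relation.Unary.Any using (here; there)
open import Data.List.Relation.Unary.All.Properties using (All¬⇒¬Any)
open import Data.List.Relation.Unary.AllPairs using (_∷_)
open import Data.List.Relation.Unary.Unique.Propositional using (Unique)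
import Data.List.Membership.Propositional as List
open import Data.Fin using (zero; suc; _≟_)
open import Data.Fin.Properties using (any?; all?; ∀-cons-⇔)
open import Data.Fin.Subset using (_∈_; _∉_; _⊆_; _⊂_; Nonempty; ∣_∣)
open import Data.Fin.Subset.Properties
  using (_∈?_; x∈∁p⇒x∉p; x∉p⇒x∈∁p; x∈p∩q⁺; x∈p∩q⁻; x∈p∧x∉q⇒x∈p─q; p─q⊆p; ⊆-antisym;
         ∉⊥; Empty-unique; nonempty?; p⊆q⇒∣p∣≤∣q∣; drop-there; drop-∷-⊆)
open import Data.Fin.Subset.Induction using (⊂-wellFounded)
open import Induction.WellFounded using (Acc; acc)
open import Data.Vec using ([]; _∷_; here; there; tabulate)
open import Data.Vec.Properties using (lookup∘tabulate; []=⇒lookup; lookup⇒[]=; ≡-dec)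
open import Data.Vec.Functional using () renaming (_∷_ to _∷ᶠ_)
open import Relation.Nullary using (Dec; yes; no; does; ¬?)
open import Relation.Nullary.Decidable
  using (map′; does-≡; dec-true; decidable-stable; _×-dec_; _→-dec_)
open import Relation.Binary.Structures using (IsPartialOrder)
open import Relation.Binary.Definitions using (DecidableEquality)
import Relation.Binary.Construct.Flip.EqAndOrd as Flip
import Relation.Binary.PropositionalEquality as ≡
open import Relation.Binary.PropositionalEquality using (_≢_)
import Relation.Binary.Reasoning.Setoid as SetoidReasoning
open import Algebra.Bundles using (Semiring)
open import Algebra.Structures using (IsCommutativeRing)
import Algebra.Definitions.RawSemiring as RawSemiring
import Algebra.Properties.Ring as RingProperties
import Algebra.Properties.Group as GroupProperties
import Algebra.Properties.AbelianGroup as AbelianGroupProperties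
import Algebra.Properties.Semigroup as SemigroupProperties
import Algebra.Properties.CommutativeSemigroup as CommSemigroupProperties

module RingSums {c ℓ} (R : CommutativeRing c ℓ) where
  open CommutativeRing R hiding (zero)
  open RawSemiring (Semiring.rawSemiring semiring) public using (_^_) renaming (_×_ to _·ₙ_)

  infixl 8 _when_
  _when_ : ∀ {p} {A : Set p} → Carrier → Dec A → Carrier
  x when d = if does d then x else 0#

  when-⇔ : ∀ {p q} {A : Set p} {B : Set q} {x} → A ⇔ B → (d : Dec A) (e : Dec B) → x when d ≡ x when e
  when-⇔ A⇔B d e = ≡.cong (λ b → if b then _ else 0#) (does-≡ d (map′ from to e))
    where open Equivalence A⇔B

  when-yes : ∀ {p} {A : Set p} {x} → A → (d : Dec A) → x when d ≡ x
  when-yes a (yes _) = ≡.refl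
  when-yes a (no ¬a) = ⊥-elim (¬a a)

  when-cong : ∀ {p} {A : Set p} {x y} (d : Dec A) → x ≈ y → x when d ≈ y when d
  when-cong (yes _) x≈y = x≈y
  when-cong (no _) _ = refl

  when-× : ∀ {p q} {A : Set p} {B : Set q} (x y : Carrier) (d : Dec A) (e : Dec B) →
           (x * y) when (d ×-dec e) ≈ x when d * y when e
  when-× x y (yes _) (yes _) = refl
  when-× x y (yes _) (no _) = sym (zeroʳ x)
  when-× x y (no _) e = sym (zeroˡ _)

  when-split : ∀ {p} {A : Set p} (x : Carrier) (d : Dec A) → x ≈ x when d + x when ¬? d
  when-split x (yes _) = sym (+-identityʳ x)
  when-split x (no _) = sym (+-identityˡ x)

  Σ : ∀ {a} {A : Set a} → List A → (A → Carrier) → Carrier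
  Σ xs f = foldr _+_ 0# (map f xs)

  Σ-cong : ∀ {a} {A : Set a} (xs : List A) {f g : A → Carrier} → (∀ x → f x ≈ g x) → Σ xs f ≈ Σ xs g
  Σ-cong [] f≈g = refl
  Σ-cong (x ∷ xs) f≈g = +-cong (f≈g x) (Σ-cong xs f≈g)

  Σ-0 : ∀ {a} {A : Set a} (xs : List A) → Σ xs (λ _ → 0#) ≈ 0#
  Σ-0 [] = refl
  Σ-0 (x ∷ xs) = trans (+-congˡ (Σ-0 xs)) (+-identityˡ 0#)

  Σ-1 : ∀ {a} {A : Set a} (xs : List A) → Σ xs (λ _ → 1#) ≈ length xs ·ₙ 1#
  Σ-1 [] = refl
  Σ-1 (x ∷ xs) = +-congˡ (Σ-1 xs)

  Σ-+ : ∀ {a} {A : Set a} (xs : List A) (f g : A → Carrier) → Σ xs (λ a → f a + g a) ≈ Σ xs f + Σ xs g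
  Σ-+ [] f g = sym (+-identityˡ 0#)
  Σ-+ (x ∷ xs) f g = trans (+-congˡ (Σ-+ xs f g)) (interchange (f x) (g x) (Σ xs f) (Σ xs g))
    where open CommSemigroupProperties +-commutativeSemigroup using (interchange)

  Σ-*ˡ : ∀ {a} {A : Set a} (xs : List A) (k : Carrier) (f : A → Carrier) → Σ xs (λ a → k * f a) ≈ k * Σ xs f
  Σ-*ˡ [] k f = sym (zeroʳ k)
  Σ-*ˡ (x ∷ xs) k f = trans (+-congˡ (Σ-*ˡ xs k f)) (sym (distribˡ k (f x) (Σ xs f)))

  Σ-*ʳ : ∀ {a} {A : Set a} (xs : List A) (k : Carrier) (f : A → Carrier) → Σ xs (λ a → f a * k) ≈ Σ xs f * k
  Σ-*ʳ [] k f = sym (zeroˡ k)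
  Σ-*ʳ (x ∷ xs) k f = trans (+-congˡ (Σ-*ʳ xs k f)) (sym (distribʳ k (f x) (Σ xs f)))

  Σ-swap : ∀ {a b} {A : Set a} {B : Set b} (xs : List A) (ys : List B) (h : A → B → Carrier) →
           Σ xs (λ a → Σ ys (h a)) ≈ Σ ys (λ b → Σ xs (λ a → h a b))
  Σ-swap [] ys h = sym (Σ-0 ys)
  Σ-swap (x ∷ xs) ys h = trans (+-congˡ (Σ-swap xs ys h)) (sym (Σ-+ ys (h x) (λ b → Σ xs (λ a → h a b))))

  Π : (n : ℕ) → (Fin n → Carrier) → Carrier
  Π zero f = 1#
  Π (suc n) f = f zero * Π n (f ∘ suc)

  Π-zero : ∀ n (f : Fin n → Carrier) i → f i ≈ 0# → Π n f ≈ 0#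
  Π-zero (suc n) f zero fi≈0 = trans (*-congʳ fi≈0) (zeroˡ _)
  Π-zero (suc n) f (suc i) fi≈0 = trans (*-congˡ (Π-zero n (f ∘ suc) i fi≈0)) (zeroʳ _)

module Enumerated {c ℓ a} (R : CommutativeRing c ℓ) {A : Set a} (_≟ᴬ_ : DecidableEquality A)
                  (elements : List A) (unique : Unique elements)
                  (complete : ∀ x → x List.∈ elements) where
  open CommutativeRing R hiding (zero)
  open RingSums R
  open SetoidReasoning setoid

  Σ-absent : ∀ {xs} b (f : A → Carrier) → b List.∉ xs → Σ xs (λ a → f a when (a ≟ᴬ b)) ≈ 0#
  Σ-absent {[]} b f b∉ = refl
  Σ-absent {x ∷ xs} b f b∉ with x ≟ᴬ b
  ... | yes ≡.refl = ⊥-elim (b∉ (here ≡.refl))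
  ... | no _ = trans (+-identityˡ _) (Σ-absent b f (b∉ ∘ there))

  Σ-δ-unique : ∀ {xs} b (f : A → Carrier) → Unique xs → b List.∈ xs → Σ xs (λ a → f a when (a ≟ᴬ b)) ≈ f b
  Σ-δ-unique {x ∷ xs} b f (x∉xs ∷ _) (here ≡.refl) with x ≟ᴬ x
  ... | yes _ = trans (+-congˡ (Σ-absent x f (All¬⇒¬Any x∉xs))) (+-identityʳ _)
  ... | no x≢x = ⊥-elim (x≢x ≡.refl)
  Σ-δ-unique {x ∷ xs} b f (x∉xs ∷ uniq) (there b∈xs) with x ≟ᴬ b
  ... | yes ≡.refl = ⊥-elim (All¬⇒¬Any x∉xs b∈xs)
  ... | no _ = trans (+-identityˡ _) (Σ-δ-unique b f uniq b∈xs)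

  Σ-δ : ∀ b (f : A → Carrier) → Σ elements (λ a → f a when (a ≟ᴬ b)) ≈ f b
  Σ-δ b f = Σ-δ-unique b f unique (complete b)

  Σ-reindex : (σ τ : A → A) → (∀ a → τ (σ a) ≡ a) → (∀ b → σ (τ b) ≡ b) →
              (g : A → Carrier) → Σ elements (g ∘ σ) ≈ Σ elements g
  Σ-reindex σ τ τσ στ g = begin
    Σ elements (g ∘ σ)
      ≈⟨ Σ-cong elements (λ a → Σ-δ (σ a) g) ⟨
    Σ elements (λ a → Σ elements (λ b → g b when (b ≟ᴬ σ a)))
      ≈⟨ Σ-swap elements elements _ ⟩
    Σ elements (λ b → Σ elements (λ a → g b when (b ≟ᴬ σ a)))
      ≈⟨ Σ-cong elements (λ b → Σ-cong elements (λ a →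
           reflexive (when-⇔ (inverse-sides b a) (b ≟ᴬ σ a) (a ≟ᴬ τ b)))) ⟩
    Σ elements (λ b → Σ elements (λ a → g b when (a ≟ᴬ τ b)))
      ≈⟨ Σ-cong elements (λ b → Σ-δ (τ b) (λ _ → g b)) ⟩
    Σ elements g ∎
    where
    inverse-sides : ∀ b a → (b ≡ σ a) ⇔ (a ≡ τ b)
    inverse-sides b a = mk⇔ (λ b≡σa → ≡.trans (≡.sym (τσ a)) (≡.cong τ (≡.sym b≡σa)))
                            (λ a≡τb → ≡.trans (≡.sym (στ b)) (≡.cong σ (≡.sym a≡τb)))

  Σ-punctured : ∀ b (f : A → Carrier) → Σ elements (λ a → f a when ¬? (a ≟ᴬ b)) ≈ Σ elements f - f b
  Σ-punctured b f = begin
    Σ elements (λ a → f a when ¬? (a ≟ᴬ b))               ≈⟨ xyx⁻¹≈y (f b) _ ⟨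
    f b + Σ elements (λ a → f a when ¬? (a ≟ᴬ b)) - f b   ≈⟨ +-congʳ (+-congʳ (Σ-δ b f)) ⟨
    Σ elements (λ a → f a when (a ≟ᴬ b))
      + Σ elements (λ a → f a when ¬? (a ≟ᴬ b)) - f b     ≈⟨ +-congʳ (Σ-+ elements _ _) ⟨
    Σ elements (λ a → f a when (a ≟ᴬ b) + f a when ¬? (a ≟ᴬ b)) - f b
                                                         ≈⟨ +-congʳ (Σ-cong elements (λ a → when-split (f a) (a ≟ᴬ b))) ⟨
    Σ elements f - f b                                   ∎
    where open AbelianGroupProperties +-abelianGroup using (xyx⁻¹≈y)

module CoordinateSums {c ℓ} (F : FiniteField) (R : CommutativeRing c ℓ) where
  private module F = FiniteField F
  open CommutativeRing R hiding (zero)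
  open RingSums R
  open SetoidReasoning setoid

  sumAll-cong : ∀ n {f g : (Fin n → F.Carrier) → Carrier} → (∀ v → f v ≈ g v) →
                sumAll F R n f ≈ sumAll F R n g
  sumAll-cong zero f≈g = f≈g (λ ())
  sumAll-cong (suc n) f≈g = Σ-cong F.elements (λ a → sumAll-cong n (λ w → f≈g (a ∷ᶠ w)))

  sumAll-*ˡ : ∀ n k (f : (Fin n → F.Carrier) → Carrier) → sumAll F R n (λ v → k * f v) ≈ k * sumAll F R n f
  sumAll-*ˡ zero k f = refl
  sumAll-*ˡ (suc n) k f = trans (Σ-cong F.elements (λ a → sumAll-*ˡ n k (λ w → f (a ∷ᶠ w))))
                                (Σ-*ˡ F.elements k (λ a → sumAll F R n (λ w → f (a ∷ᶠ w))))

  sumAll-product : ∀ {p} n (A : Fin n → F.Carrier → Set p) (A? : ∀ i a → Dec (A i a))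
                   (all-A? : ∀ v → Dec (∀ i → A i (v i))) (h : Fin n → F.Carrier → Carrier) →
                   sumAll F R n (λ v → Π n (λ i → h i (v i)) when all-A? v)
                     ≈ Π n (λ i → Σ F.elements (λ a → h i a when A? i a))
  sumAll-product zero A A? all-A? h = reflexive (when-yes (λ ()) (all-A? (λ ())))
  sumAll-product (suc n) A A? all-A? h = begin
    Σ F.elements (λ a → sumAll F R n (λ w → (h zero a * rest w) when all-A? (a ∷ᶠ w)))
      ≈⟨ Σ-cong F.elements (λ a → sumAll-cong n (λ w → split a w)) ⟩
    Σ F.elements (λ a → sumAll F R n (λ w → h zero a when A? zero a * rest w when tail? w))
      ≈⟨ Σ-cong F.elements (λ a → sumAll-*ˡ n _ _) ⟩
    Σ F.elements (λ a → h zero a when A? zero a * sumAll F R n (λ w → rest w when tail? w))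
      ≈⟨ Σ-cong F.elements (λ a → *-congˡ (sumAll-product n (A ∘ suc) (A? ∘ suc) tail? (h ∘ suc))) ⟩
    Σ F.elements (λ a → h zero a when A? zero a * Π n (λ i → Σ F.elements (λ b → h (suc i) b when A? (suc i) b)))
      ≈⟨ Σ-*ʳ F.elements _ _ ⟩
    Π (suc n) (λ i → Σ F.elements (λ a → h i a when A? i a)) ∎
    where
    rest : (Fin n → F.Carrier) → Carrier
    rest w = Π n (λ i → h (suc i) (w i))
    tail? : ∀ w → Dec (∀ i → A (suc i) (w i))
    tail? w = all? (λ i → A? (suc i) (w i))
    split : ∀ a w → (h zero a * rest w) when all-A? (a ∷ᶠ w) ≈ h zero a when A? zero a * rest w when tail? w
    split a w = trans (reflexive (when-⇔ (⇔.sym ∀-cons-⇔) (all-A? (a ∷ᶠ w)) (A? zero a ×-dec tail? w)))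
                      (when-× _ _ (A? zero a) (tail? w))

module CharacterSums {c ℓ} (F : FiniteField) (R : CommutativeRing c ℓ) (ψ : AdditiveCharacter F R) where
  private
    module F = FiniteField F
    module F-ring = IsCommutativeRing F.isCommutativeRing
  open CommutativeRing R hiding (zero)
  open AdditiveCharacter ψ
  open RingSums R
  open Enumerated R F._≟F_ F.elements F.elements-unique F.elements-complete
  open SetoidReasoning setoid

  χ-dot : ∀ n (u v : Fin n → F.Carrier) → χ (dotF F u v) ≈ Π n (λ i → χ (u i F.* v i))
  χ-dot zero u v = χ-0
  χ-dot (suc n) u v = trans (χ-+ _ _) (*-congˡ (χ-dot n (u ∘ suc) (v ∘ suc)))

  Σχ-trivial : ∀ {t} → t ≡ F.0# → Σ F.elements (λ a → χ (t F.* a)) ≈ F.q ·ₙ 1#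
  Σχ-trivial ≡.refl = trans (Σ-cong F.elements (λ a → trans (reflexive (≡.cong χ (F-ring.zeroˡ a))) χ-0))
                            (Σ-1 F.elements)

  q·1-1 : F.q ·ₙ 1# - 1# ≈ (F.q ∸ 1) ·ₙ 1#
  q·1-1 = nonempty F.elements (F.elements-complete F.0#)
    where
    open AbelianGroupProperties +-abelianGroup using (xyx⁻¹≈y)
    nonempty : ∀ xs → F.0# List.∈ xs → length xs ·ₙ 1# - 1# ≈ (length xs ∸ 1) ·ₙ 1#
    nonempty (_ ∷ xs) _ = xyx⁻¹≈y 1# _

  private
    -- x ∙ (y ∙ a) = a when x ∙ y is the identity: translations and scalings
    -- by units are bijections of F
    undo : (_∙_ : F.Carrier → F.Carrier → F.Carrier) {e : F.Carrier} →
           (∀ x y z → (x ∙ y) ∙ z ≡ x ∙ (y ∙ z)) → (∀ x → e ∙ x ≡ x) →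
           ∀ {x y} → x ∙ y ≡ e → ∀ a → x ∙ (y ∙ a) ≡ a
    undo _∙_ assoc identityˡ {x} {y} xy≡e a =
      ≡.trans (≡.sym (assoc x y a)) (≡.trans (≡.cong (_∙ a) xy≡e) (identityˡ a))

  module _ (domain : IsIntegralDomain R) (nontrivial : Nontrivial ψ) where
    open IsIntegralDomain domain

    -- orthogonality: a nontrivial character sums to 0, since χ b · Σχ = Σχ
    -- with χ b ≠ 1 and R has no zero divisors
    Σχ≈0 : Σ F.elements χ ≈ 0#
    Σχ≈0 = vanish nontrivial
      where
      vanish : Nontrivial ψ → Σ F.elements χ ≈ 0#
      vanish (b , χb≉1) =
        [ (λ χb-1≈0 → ⊥-elim (χb≉1 (x∙y⁻¹≈ε⇒x≈y (χ b) 1# χb-1≈0))) , (λ T≈0 → T≈0) ]′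
          (noZeroDivisors (χ b - 1#) T scaled-T≈0)
        where
        open GroupProperties +-group using (x∙y⁻¹≈ε⇒x≈y)
        T = Σ F.elements χ
        translation-invariant : χ b * T ≈ T
        translation-invariant = begin
          χ b * T                               ≈⟨ Σ-*ˡ F.elements (χ b) χ ⟨
          Σ F.elements (λ a → χ b * χ a)        ≈⟨ Σ-cong F.elements (λ a → χ-+ b a) ⟨
          Σ F.elements (λ a → χ (b F.+ a))      ≈⟨ Σ-reindex (b F.+_) (F.- b F.+_)
                                                     (undo F._+_ F-ring.+-assoc F-ring.+-identityˡ (F-ring.-‿inverseˡ b))
                                                     (undo F._+_ F-ring.+-assoc F-ring.+-identityˡ (F-ring.-‿inverseʳ b)) χ ⟩
          T                                     ∎
        scaled-T≈0 : (χ b - 1#) * T ≈ 0#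
        scaled-T≈0 = begin
          (χ b - 1#) * T       ≈⟨ distribʳ T (χ b) (- 1#) ⟩
          χ b * T + - 1# * T   ≈⟨ +-cong translation-invariant (-1*x≈-x T) ⟩
          T - T                ≈⟨ -‿inverseʳ T ⟩
          0#                   ∎
          where open RingProperties ring using (-1*x≈-x)

    -- Σ_a χ(t a) = 0 when t ≠ 0, since a ↦ t a permutes F
    Σχ-nontrivial : ∀ {t} → t ≢ F.0# → Σ F.elements (λ a → χ (t F.* a)) ≈ 0#
    Σχ-nontrivial {t} t≢0 with F.inverse t t≢0
    ... | t⁻¹ , tt⁻¹≡1 = trans (Σ-reindex (t F.*_) (t⁻¹ F.*_)
                                 (undo F._*_ F-ring.*-assoc F-ring.*-identityˡ (≡.trans (F-ring.*-comm t⁻¹ t) tt⁻¹≡1))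
                                 (undo F._*_ F-ring.*-assoc F-ring.*-identityˡ tt⁻¹≡1) χ)
                               Σχ≈0

module SubsetFacts where

  ∈-tabulate⁺ : ∀ {p n} {Q : Fin n → Set p} (Q? : ∀ i → Dec (Q i)) {i} → Q i → i ∈ tabulate (λ j → does (Q? j))
  ∈-tabulate⁺ Q? {i} q = lookup⇒[]= i _ (≡.trans (lookup∘tabulate (λ j → does (Q? j)) i) (dec-true (Q? i) q))

  ∈-tabulate⁻ : ∀ {p n} {Q : Fin n → Set p} (Q? : ∀ i → Dec (Q i)) {i} → i ∈ tabulate (λ j → does (Q? j)) → Q i
  ∈-tabulate⁻ Q? {i} i∈ with Q? i | ≡.trans (≡.sym (lookup∘tabulate (λ j → does (Q? j)) i)) ([]=⇒lookup i∈)
  ... | yes q | _ = q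
  ... | no _ | ()

  x∈p─q⁻ : ∀ {n} {p q : Subset n} {x} → x ∈ p ─ q → x ∉ q
  x∈p─q⁻ {p = _ ∷ p} {true ∷ q} () here
  x∈p─q⁻ {p = _ ∷ p} {false ∷ q} here ()
  x∈p─q⁻ {p = _ ∷ p} {_ ∷ q} (there x∈) (there x∈q) = x∈p─q⁻ x∈ x∈q

  ≢⊥⇒Nonempty : ∀ {n} {p : Subset n} → ¬ (p ≡ ⊥) → Nonempty p
  ≢⊥⇒Nonempty {p = p} p≢⊥ = decidable-stable (nonempty? p) (λ ¬nonempty → p≢⊥ (Empty-unique ¬nonempty))

-- The dual poset P*.  Its ideals, generated ideals and maximal elements are
-- definitionally the up-sets ideal*⟨_⟩ and maxP* of P.
dual : ∀ {n} → FinPoset n → FinPoset n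
dual P = record { _≼_ = flip _≼_ ; isPartialOrder = Flip.isPartialOrder isPartialOrder ; _≼?_ = flip _≼?_ }
  where open FinPoset P

dual-ideal-∁ : ∀ {n} (P : FinPoset n) {J : Subset n} → IsIdeal P J → IsIdeal (dual P) (∁ J)
dual-ideal-∁ P J-ideal j∈∁J j≽i = x∉p⇒x∈∁p (λ i∈J → x∈∁p⇒x∉p j∈∁J (J-ideal i∈J j≽i))

module PosetFacts {n} (P : FinPoset n) where
  open FinPoset P
  open SubsetFacts
  module ≼ = IsPartialOrder isPartialOrder

  ∈-ideal⁺ : ∀ {X i j} → j ∈ X → i ≼ j → i ∈ ideal⟨_⟩ P X
  ∈-ideal⁺ {X} j∈X i≼j = ∈-tabulate⁺ (λ i → any? (λ j → (j ∈? X) ×-dec (i ≼? j))) (_ , j∈X , i≼j)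

  ∈-ideal⁻ : ∀ {X i} → i ∈ ideal⟨_⟩ P X → ∃ λ j → j ∈ X × i ≼ j
  ∈-ideal⁻ {X} = ∈-tabulate⁻ (λ i → any? (λ j → (j ∈? X) ×-dec (i ≼? j)))

  IsMaximalIn : Subset n → Fin n → Set
  IsMaximalIn X i = ∀ {j} → j ∈ X → i ≼ j → i ≡ j

  strictly-above? : (X : Subset n) (i : Fin n) → Dec (∃ λ j → j ∈ X × i ≼ j × i ≢ j)
  strictly-above? X i = any? λ j → (j ∈? X) ×-dec (i ≼? j) ×-dec ¬? (i ≟ j)

  maximal? : (X : Subset n) (i : Fin n) → Dec (i ∈ X × ¬ (∃ λ j → j ∈ X × i ≼ j × i ≢ j))
  maximal? X i = (i ∈? X) ×-dec ¬? (strictly-above? X i)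

  ∈-maxP⁺ : ∀ {X i} → i ∈ X → IsMaximalIn X i → i ∈ maxP P X
  ∈-maxP⁺ {X} i∈X i-max = ∈-tabulate⁺ (maximal? X) (i∈X , λ (_ , j∈X , i≼j , i≢j) → i≢j (i-max j∈X i≼j))

  ∈-maxP⁻ : ∀ {X i} → i ∈ maxP P X → i ∈ X × IsMaximalIn X i
  ∈-maxP⁻ {X} {i} i∈maxX with ∈-tabulate⁻ (maximal? X) i∈maxX
  ... | i∈X , nothing-above =
    i∈X , λ {j} j∈X i≼j → decidable-stable (i ≟ j) (λ i≢j → nothing-above (j , j∈X , i≼j , i≢j))

  ∉-maxP : ∀ {X i} → i ∈ X → i ∉ maxP P X → ∃ λ j → j ∈ X × i ≼ j × i ≢ j
  ∉-maxP {X} {i} i∈X i∉maxX = decidable-stable (strictly-above? X i) λ nothing-above →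
    i∉maxX (∈-maxP⁺ i∈X (λ {j} j∈X i≼j → decidable-stable (i ≟ j) (λ i≢j → nothing-above (j , j∈X , i≼j , i≢j))))

  -- every element of X lies below a maximal element of X; by well-founded
  -- induction on the up-set ↑ i, which shrinks strictly when climbing
  maximal-above : ∀ {X i} → i ∈ X → ∃ λ m → i ≼ m × m ∈ maxP P X
  maximal-above {X} {i} i∈X = climb i (⊂-wellFounded (↑ i)) i∈X
    where
    ↑ : Fin n → Subset n
    ↑ i = tabulate (λ k → does (i ≼? k))

    ↑-shrinks : ∀ {i j} → i ≼ j → i ≢ j → ↑ j ⊂ ↑ i
    ↑-shrinks {i} {j} i≼j i≢j =
      (λ k∈↑j → ∈-tabulate⁺ (i ≼?_) (≼.trans i≼j (∈-tabulate⁻ (j ≼?_) k∈↑j))) ,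
      i , ∈-tabulate⁺ (i ≼?_) ≼.refl , λ i∈↑j → i≢j (≼.antisym i≼j (∈-tabulate⁻ (j ≼?_) i∈↑j))

    climb : ∀ i → Acc _⊂_ (↑ i) → i ∈ X → ∃ λ m → i ≼ m × m ∈ maxP P X
    climb i (acc smaller) i∈X with i ∈? maxP P X
    ... | yes i∈maxX = i , ≼.refl , i∈maxX
    ... | no i∉maxX with ∉-maxP i∈X i∉maxX
    ...   | j , j∈X , i≼j , i≢j with climb j (smaller (↑-shrinks i≼j i≢j)) j∈X
    ...     | m , j≼m , m∈maxX = m , ≼.trans i≼j j≼m , m∈maxX

  generators-bounds : ∀ {S K} → ideal⟨_⟩ P S ≡ K → S ⊆ K × maxP P K ⊆ S
  generators-bounds {S} ≡.refl = (λ s∈S → ∈-ideal⁺ s∈S ≼.refl) , below-generator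
    where
    below-generator : maxP P (ideal⟨_⟩ P S) ⊆ S
    below-generator m∈max with ∈-maxP⁻ m∈max
    ... | m∈K , m-max with ∈-ideal⁻ m∈K
    ...   | j , j∈S , m≼j = ≡.subst (_∈ S) (≡.sym (m-max (∈-ideal⁺ j∈S ≼.refl) m≼j)) j∈S

  generated-by : ∀ {S K} → IsIdeal P K → S ⊆ K → maxP P K ⊆ S → ideal⟨_⟩ P S ≡ K
  generated-by {S} {K} K-ideal S⊆K maxK⊆S = ⊆-antisym ideal⊆K K⊆ideal
    where
    ideal⊆K : ideal⟨_⟩ P S ⊆ K
    ideal⊆K i∈ with ∈-ideal⁻ i∈
    ... | j , j∈S , i≼j = K-ideal (S⊆K j∈S) i≼j
    K⊆ideal : K ⊆ ideal⟨_⟩ P S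
    K⊆ideal i∈K with maximal-above i∈K
    ... | m , i≼m , m∈maxK = ∈-ideal⁺ (maxK⊆S m∈maxK) i≼m

module WeightedProducts {c ℓ} (R : CommutativeRing c ℓ) (Q₁ Q : CommutativeRing.Carrier R) where
  open CommutativeRing R hiding (zero)
  open RingSums R
  open SemigroupProperties *-semigroup using (x∙yz≈xy∙z)
  open CommSemigroupProperties *-commutativeSemigroup using (x∙yz≈y∙xz)

  record Weights {n} (x m r : Subset n) (f : Fin n → Carrier) : Set ℓ where
    field
      on-x      : ∀ {i} → i ∈ x → f i ≈ - 1#
      on-m      : ∀ {i} → i ∈ m → i ∉ x → f i ≈ Q₁
      on-r      : ∀ {i} → i ∈ r → f i ≈ Q
      elsewhere : ∀ {i} → i ∉ m → i ∉ r → f i ≈ 1#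

  weights-tail : ∀ {n x₀ m₀ r₀} {x m r : Subset n} {f} →
                 Weights (x₀ ∷ x) (m₀ ∷ m) (r₀ ∷ r) f → Weights x m r (f ∘ suc)
  weights-tail w = record
    { on-x      = λ i∈x → on-x (there i∈x)
    ; on-m      = λ i∈m i∉x → on-m (there i∈m) (i∉x ∘ drop-there)
    ; on-r      = λ i∈r → on-r (there i∈r)
    ; elsewhere = λ i∉m i∉r → elsewhere (i∉m ∘ drop-there) (i∉r ∘ drop-there)
    }
    where open Weights w

  Π-weights : ∀ {n} {x m r : Subset n} {f} → x ⊆ m → (∀ {i} → i ∈ m → i ∉ r) → Weights x m r f →
              Π n f ≈ (- 1#) ^ ∣ x ∣ * Q₁ ^ (∣ m ∣ ∸ ∣ x ∣) * Q ^ ∣ r ∣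
  Π-weights {zero} {[]} {[]} {[]} _ _ _ = sym (trans (*-identityʳ _) (*-identityʳ _))
  Π-weights {suc n} {x₀ ∷ x} {m₀ ∷ m} {r₀ ∷ r} {f} x⊆m disjoint w =
    trans (*-congˡ (Π-weights (drop-∷-⊆ x⊆m) (λ i∈m i∈r → disjoint (there i∈m) (there i∈r)) (weights-tail w)))
          (extend x₀ m₀ r₀ x⊆m disjoint w)
    where
    A = (- 1#) ^ ∣ x ∣
    B = Q₁ ^ (∣ m ∣ ∸ ∣ x ∣)
    C = Q ^ ∣ r ∣
    ∣x∣≤∣m∣ = p⊆q⇒∣p∣≤∣q∣ (drop-∷-⊆ x⊆m)
    extend : ∀ x₀ m₀ r₀ → (x₀ ∷ x) ⊆ (m₀ ∷ m) → (∀ {i} → i ∈ m₀ ∷ m → i ∉ r₀ ∷ r) →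
             Weights (x₀ ∷ x) (m₀ ∷ m) (r₀ ∷ r) f →
             f zero * (A * B * C) ≈ (- 1#) ^ ∣ x₀ ∷ x ∣ * Q₁ ^ (∣ m₀ ∷ m ∣ ∸ ∣ x₀ ∷ x ∣) * Q ^ ∣ r₀ ∷ r ∣
    extend true false _ x⊆m _ _ with x⊆m here
    ... | ()
    extend _ true true _ disjoint _ = ⊥-elim (disjoint here here)
    extend true true false _ _ ws =
      trans (*-congʳ (Weights.on-x ws here)) (trans (x∙yz≈xy∙z _ _ C) (*-congʳ (x∙yz≈xy∙z _ A B)))
    extend false true false _ _ ws rewrite +-∸-assoc 1 ∣x∣≤∣m∣ =
      trans (*-congʳ (Weights.on-m ws here λ ())) (trans (x∙yz≈xy∙z _ _ C) (*-congʳ (x∙yz≈y∙xz _ A B)))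
    extend false false true _ _ ws = trans (*-congʳ (Weights.on-r ws here)) (x∙yz≈y∙xz _ (A * B) C)
    extend false false false _ _ ws = trans (*-congʳ (Weights.elsewhere ws (λ ()) (λ ()))) (*-identityˡ _)

module SphereSums {c ℓ} (F : FiniteField) (R : CommutativeRing c ℓ) (ψ : AdditiveCharacter F R)
                  {n} (P : FinPoset n) (J : Subset n) (J-ideal : IsIdeal P J) where
  private
    module F = FiniteField F
    module F-ring = IsCommutativeRing F.isCommutativeRing
    module P = PosetFacts P
    module P* = PosetFacts (dual P)
  open CommutativeRing R hiding (zero)
  open AdditiveCharacter ψ
  open RingSums R
  open CoordinateSums F R
  open CharacterSums F R ψ
  open Enumerated R F._≟F_ F.elements F.elements-unique F.elements-complete
  open SubsetFacts
  open SetoidReasoning setoid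

  M : Subset n
  M = maxP* P (∁ J)

  M-outside-J : ∀ {i} → i ∈ M → i ∉ J
  M-outside-J i∈M = x∈∁p⇒x∉p (proj₁ (P*.∈-maxP⁻ i∈M))

  ∈-supp⁺ : ∀ {v : Fin n → F.Carrier} {i} → v i ≢ F.0# → i ∈ supp F v
  ∈-supp⁺ {v} = ∈-tabulate⁺ (λ i → ¬? (v i F.≟F F.0#))

  ∈-supp⁻ : ∀ {v : Fin n → F.Carrier} {i} → i ∈ supp F v → v i ≢ F.0#
  ∈-supp⁻ {v} = ∈-tabulate⁻ (λ i → ¬? (v i F.≟F F.0#))

  Admissible : Fin n → F.Carrier → Set
  Admissible i a = (i ∈ J → a ≡ F.0#) × (i ∈ M → a ≢ F.0#)

  admissible? : ∀ i a → Dec (Admissible i a)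
  admissible? i a = ((i ∈? J) →-dec (a F.≟F F.0#)) ×-dec ((i ∈? M) →-dec ¬? (a F.≟F F.0#))

  sphere⇔ : ∀ v → (ideal*⟨_⟩ P (supp F v) ≡ ∁ J) ⇔ (∀ i → Admissible i (v i))
  sphere⇔ v = mk⇔ admissible generated
    where
    admissible : ideal*⟨_⟩ P (supp F v) ≡ ∁ J → ∀ i → Admissible i (v i)
    admissible generates i with P*.generators-bounds generates
    ... | supp⊆∁J , M⊆supp =
      (λ i∈J → decidable-stable (v i F.≟F F.0#) (λ vi≢0 → x∈∁p⇒x∉p (supp⊆∁J (∈-supp⁺ vi≢0)) i∈J)) ,
      (λ i∈M → ∈-supp⁻ (M⊆supp i∈M))
    generated : (∀ i → Admissible i (v i)) → ideal*⟨_⟩ P (supp F v) ≡ ∁ J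
    generated adm = P*.generated-by (dual-ideal-∁ P J-ideal)
      (λ {i} i∈supp → x∉p⇒x∈∁p (λ i∈J → ∈-supp⁻ i∈supp (proj₁ (adm i) i∈J)))
      (λ {i} i∈M → ∈-supp⁺ (proj₂ (adm i) i∈M))

  local : Fin n → F.Carrier → Carrier
  local i t = Σ F.elements (λ a → χ (t F.* a) when admissible? i a)

  charSum-factorises : ∀ u → charSum F R P ψ u J ≈ Π n (λ i → local i (u i))
  charSum-factorises u = begin
    charSum F R P ψ u J
      ≈⟨ sumAll-cong n (λ v → trans (reflexive (when-⇔ (sphere⇔ v) (≡-dec Bool._≟_ _ _) (all-admissible? v)))
                                    (when-cong (all-admissible? v) (χ-dot n u v))) ⟩
    sumAll F R n (λ v → Π n (λ i → χ (u i F.* v i)) when all-admissible? v)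
      ≈⟨ sumAll-product n Admissible admissible? all-admissible? (λ i a → χ (u i F.* a)) ⟩
    Π n (λ i → local i (u i)) ∎
    where
    all-admissible? : ∀ v → Dec (∀ i → Admissible i (v i))
    all-admissible? v = all? λ i → admissible? i (v i)

  χ-at-0 : ∀ t → χ (t F.* F.0#) ≈ 1#
  χ-at-0 t = trans (reflexive (≡.cong χ (F-ring.zeroʳ t))) χ-0

  local-J : ∀ {i} t → i ∈ J → local i t ≈ 1#
  local-J {i} t i∈J = begin
    local i t
      ≈⟨ Σ-cong F.elements (λ a → reflexive (when-⇔ only-zero (admissible? i a) (a F.≟F F.0#))) ⟩
    Σ F.elements (λ a → χ (t F.* a) when (a F.≟F F.0#))    ≈⟨ Σ-δ F.0# _ ⟩
    χ (t F.* F.0#)                                          ≈⟨ χ-at-0 t ⟩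
    1#                                                      ∎
    where
    only-zero : ∀ {a} → Admissible i a ⇔ (a ≡ F.0#)
    only-zero = mk⇔ (λ adm → proj₁ adm i∈J) (λ a≡0 → (λ _ → a≡0) , λ i∈M → ⊥-elim (M-outside-J i∈M i∈J))

  local-M : ∀ {i} t → i ∈ M → local i t ≈ Σ F.elements (λ a → χ (t F.* a)) - 1#
  local-M {i} t i∈M = begin
    local i t
      ≈⟨ Σ-cong F.elements (λ a → reflexive (when-⇔ only-nonzero (admissible? i a) (¬? (a F.≟F F.0#)))) ⟩
    Σ F.elements (λ a → χ (t F.* a) when ¬? (a F.≟F F.0#))  ≈⟨ Σ-punctured F.0# _ ⟩
    Σ F.elements (λ a → χ (t F.* a)) - χ (t F.* F.0#)        ≈⟨ +-congˡ (-‿cong (χ-at-0 t)) ⟩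
    Σ F.elements (λ a → χ (t F.* a)) - 1#                    ∎
    where
    only-nonzero : ∀ {a} → Admissible i a ⇔ (a ≢ F.0#)
    only-nonzero = mk⇔ (λ adm → proj₂ adm i∈M)
                       (λ a≢0 → (λ i∈J → ⊥-elim (M-outside-J i∈M i∈J)) , λ _ → a≢0)

  local-rest : ∀ {i} t → i ∉ J → i ∉ M → local i t ≈ Σ F.elements (λ a → χ (t F.* a))
  local-rest {i} t i∉J i∉M =
    Σ-cong F.elements (λ a → reflexive (when-yes ((λ i∈J → ⊥-elim (i∉J i∈J)) , λ i∈M → ⊥-elim (i∉M i∈M))
                                                 (admissible? i a)))

  module Evaluation (domain : IsIntegralDomain R) (nontrivial : Nontrivial ψ)
                    {I : Subset n} (I-ideal : IsIdeal P I)
                    (u : Fin n → F.Carrier) (generates : ideal⟨_⟩ P (supp F u) ≡ I) where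
    open FinPoset P using (_≼_)
    open WeightedProducts R ((F.q ∸ 1) ·ₙ 1#) (F.q ·ₙ 1#)

    vanishes-outside-I : ∀ {i} → i ∉ I → u i ≡ F.0#
    vanishes-outside-I {i} i∉I =
      decidable-stable (u i F.≟F F.0#) (λ ui≢0 → i∉I (proj₁ (P.generators-bounds generates) (∈-supp⁺ ui≢0)))

    nonzero-on-maxI : ∀ {i} → i ∈ maxP P I → u i ≢ F.0#
    nonzero-on-maxI i∈maxI = ∈-supp⁻ (proj₂ (P.generators-bounds generates) i∈maxI)

    charSum-empty : (I ─ maxP P I) ∩ ∁ J ≡ ⊥ → charSum F R P ψ u J ≈ rhsValue F R P I J
    charSum-empty V≡⊥ = trans (charSum-factorises u) (Π-weights x⊆M disjoint weights)
      where
      I∩∁J⊆maxI : ∀ {i} → i ∈ I → i ∈ ∁ J → i ∈ maxP P I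
      I∩∁J⊆maxI i∈I i∈∁J = decidable-stable (_ ∈? maxP P I) λ i∉maxI →
        ∉⊥ (≡.subst (_ ∈_) V≡⊥ (x∈p∩q⁺ (x∈p∧x∉q⇒x∈p─q i∈I i∉maxI , i∈∁J)))

      I∩∁J⊆M : ∀ {i} → i ∈ I → i ∈ ∁ J → i ∈ M
      I∩∁J⊆M i∈I i∈∁J = P*.∈-maxP⁺ i∈∁J λ j∈∁J j≼i →
        ≡.sym (proj₂ (P.∈-maxP⁻ (I∩∁J⊆maxI (I-ideal i∈I j≼i) j∈∁J)) i∈I j≼i)

      x⊆M : I ∩ ∁ J ⊆ M
      x⊆M i∈x = let i∈I , i∈∁J = x∈p∩q⁻ I (∁ J) i∈x in I∩∁J⊆M i∈I i∈∁J

      disjoint : ∀ {i} → i ∈ M → i ∉ ∁ J ─ M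
      disjoint i∈M i∈r = x∈p─q⁻ i∈r i∈M

      weights : Weights (I ∩ ∁ J) M (∁ J ─ M) (λ i → local i (u i))
      weights = record
        { on-x = λ {i} i∈x → let i∈I , i∈∁J = x∈p∩q⁻ I (∁ J) i∈x in begin
            local i (u i)                              ≈⟨ local-M (u i) (I∩∁J⊆M i∈I i∈∁J) ⟩
            Σ F.elements (λ a → χ (u i F.* a)) - 1#    ≈⟨ +-congʳ (Σχ-nontrivial domain nontrivial
                                                             (nonzero-on-maxI (I∩∁J⊆maxI i∈I i∈∁J))) ⟩
            0# - 1#                                    ≈⟨ +-identityˡ _ ⟩
            - 1#                                       ∎
        ; on-m = λ {i} i∈M i∉x → let i∈∁J = proj₁ (P*.∈-maxP⁻ i∈M) in begin
            local i (u i)                              ≈⟨ local-M (u i) i∈M ⟩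
            Σ F.elements (λ a → χ (u i F.* a)) - 1#    ≈⟨ +-congʳ (Σχ-trivial (vanishes-outside-I
                                                             (λ i∈I → i∉x (x∈p∩q⁺ (i∈I , i∈∁J))))) ⟩
            F.q ·ₙ 1# - 1#                             ≈⟨ q·1-1 ⟩
            (F.q ∸ 1) ·ₙ 1#                            ∎
        ; on-r = λ {i} i∈r → let i∈∁J = p─q⊆p (∁ J) M i∈r ; i∉M = x∈p─q⁻ i∈r in begin
            local i (u i)                              ≈⟨ local-rest (u i) (x∈∁p⇒x∉p i∈∁J) i∉M ⟩
            Σ F.elements (λ a → χ (u i F.* a))         ≈⟨ Σχ-trivial (vanishes-outside-I
                                                             (λ i∈I → i∉M (I∩∁J⊆M i∈I i∈∁J))) ⟩
            F.q ·ₙ 1#                                  ∎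
        ; elsewhere = λ {i} i∉M i∉r → local-J (u i)
            (decidable-stable (i ∈? J) λ i∉J → i∉r (x∈p∧x∉q⇒x∈p─q (x∉p⇒x∈∁p i∉J) i∉M))
        }

    vanishing-coordinate : Nonempty ((I ─ maxP P I) ∩ ∁ J) → ∃ λ m → m ∈ ∁ J × m ∉ M × u m ≢ F.0#
    vanishing-coordinate (i , i∈V) with x∈p∩q⁻ (I ─ maxP P I) (∁ J) i∈V
    ... | i∈I─maxI , i∈∁J with P.∉-maxP (p─q⊆p I (maxP P I) i∈I─maxI) (x∈p─q⁻ i∈I─maxI)
    ...   | j , j∈I , i≼j , i≢j with P.maximal-above j∈I
    ...     | m , j≼m , m∈maxI = m , m∈∁J , m∉M , nonzero-on-maxI m∈maxI
      where
      i≼m : i ≼ m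
      i≼m = P.≼.trans i≼j j≼m
      m∈∁J : m ∈ ∁ J
      m∈∁J = dual-ideal-∁ P J-ideal i∈∁J i≼m
      m∉M : m ∉ M
      m∉M m∈M = i≢j (P.≼.antisym i≼j (≡.subst (j ≼_) (proj₂ (P*.∈-maxP⁻ m∈M) i∈∁J i≼m) j≼m))

    charSum-nonempty : ¬ ((I ─ maxP P I) ∩ ∁ J ≡ ⊥) → charSum F R P ψ u J ≈ 0#
    charSum-nonempty V≢⊥ =
      let m , m∈∁J , m∉M , um≢0 = vanishing-coordinate (≢⊥⇒Nonempty V≢⊥) in
      trans (charSum-factorises u) (Π-zero n _ m (begin
        local m (u m)                         ≈⟨ local-rest (u m) (x∈∁p⇒x∉p m∈∁J) m∉M ⟩
        Σ F.elements (λ a → χ (u m F.* a))    ≈⟨ Σχ-nontrivial domain nontrivial um≢0 ⟩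
        0#                                    ∎))

lemma3p7 : ∀ {c ℓ} (F : FiniteField) (R : CommutativeRing c ℓ) →
    IsIntegralDomain R →
    (ψ : AdditiveCharacter F R) → Nontrivial ψ →
    (n : ℕ) (P : FinPoset n) (I J : Subset n) →
    IsIdeal P I → IsIdeal P J →
    (u : Fin n → FiniteField.Carrier F) → ideal⟨_⟩ P (supp F u) ≡ I →
    ((I ─ maxP P I) ∩ ∁ J ≡ ⊥ →
      CommutativeRing._≈_ R (charSum F R P ψ u J) (rhsValue F R P I J))
    × (¬ ((I ─ maxP P I) ∩ ∁ J ≡ ⊥) →
      CommutativeRing._≈_ R (charSum F R P ψ u J) (CommutativeRing.0# R))
lemma3p7 F R domain ψ nontrivial n P I J I-ideal J-ideal u generates = charSum-empty , charSum-nonempty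
  where open SphereSums.Evaluation F R ψ P J J-ideal domain nontrivial I-ideal u generates
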